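{- Let $\mathbb{F}_q$ be a finite field and $m>1$ an integer. Then $$\tilde{P}_m(0)=\sum_{k=1}^{m-2}(-1)^{k+1}\Big((q-1)N(k,1,\mathbb{F}_q^*)\tilde{P}_{m-k}(1)+N(k,0,\mathbb{F}_q^*)\tilde{P}_{m-k}(0)\Big)+(-1)^m(q-1)N(m-1,1,\mathbb{F}_q^*)+(-1)^{m+1}N(m,0,\mathbb{F}_q^*).$$
   Context: $\tilde{P}_j(z)$ denotes the number of multisets of $j$ elements of $\mathbb{F}_q^*=\mathbb{F}_q\setminus\{0\}$ (repetitions allowed) whose sum is $z$. $N(k,b,\mathbb{F}_q^*)$ denotes the number of $k$-element subsets (all elements distinct) of $\mathbb{F}_q^*$ whose elements sum to $b\in\mathbb{F}_q$. -}

module Defs where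

open import Level using (Level; _⊔_)
open import Algebra.Bundles using (CommutativeRing)
open import Data.Nat as ℕ using (ℕ; zero; suc; _∸_; _<ᵇ_; _≤ᵇ_)
open import Data.Fin using (Fin; toℕ)
open import Data.Vec as Vec using (Vec; []; _∷_)
open import Data.List as List using (List; []; _∷_; length; filterᵇ; concatMap; allFin)
open import Data.Bool using (Bool; true; false; _∧_; not)
open import Data.Product using (∃)
open import Data.Integer as ℤ using (ℤ; +_; -1ℤ)
open import Relation.Nullary using (¬_; does)
open import Relation.Binary using (Decidable)
open import Relation.Binary.PropositionalEquality using (_≡_)

record FiniteField (c ℓ : Level) : Set (Level.suc (c ⊔ ℓ)) where
  field
    commRing  : CommutativeRing c ℓ
  open CommutativeRing commRing public
  field
    1≉0       : ¬ (1# ≈ 0#)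
    inverse   : ∀ x → ¬ (x ≈ 0#) → ∃ λ y → (x * y) ≈ 1#
    _≟_       : Decidable _≈_
    size      : ℕ
    enum      : Fin size → Carrier
    enum-inj  : ∀ i j → enum i ≈ enum j → i ≡ j
    enum-surj : ∀ x → ∃ λ i → enum i ≈ x

allVecs : (n j : ℕ) → List (Vec (Fin n) j)
allVecs n zero    = [] ∷ []
allVecs n (suc j) = concatMap (λ i → List.map (i ∷_) (allVecs n j)) (allFin n)

nonDecr : ∀ {n j} → Vec (Fin n) j → Bool
nonDecr []           = true
nonDecr (x ∷ [])     = true
nonDecr (x ∷ y ∷ xs) = (toℕ x ≤ᵇ toℕ y) ∧ nonDecr (y ∷ xs)

strictIncr : ∀ {n j} → Vec (Fin n) j → Bool
strictIncr []           = true
strictIncr (x ∷ [])     = true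
strictIncr (x ∷ y ∷ xs) = (toℕ x <ᵇ toℕ y) ∧ strictIncr (y ∷ xs)

module _ {c ℓ} (F : FiniteField c ℓ) where
  open FiniteField F

  isNonzero : Fin size → Bool
  isNonzero i = not (does (enum i ≟ 0#))

  allNonzero : ∀ {j} → Vec (Fin size) j → Bool
  allNonzero []       = true
  allNonzero (x ∷ xs) = isNonzero x ∧ allNonzero xs

  vsum : ∀ {j} → Vec (Fin size) j → Carrier
  vsum []       = 0#
  vsum (x ∷ xs) = enum x + vsum xs

  sumIs : ∀ {j} → Carrier → Vec (Fin size) j → Bool
  sumIs z v = does (vsum v ≟ z)

  -- P̃_j(z): number of multisets of j elements of F_q^* summing to z.
  -- A multiset of size j is encoded uniquely by its non-decreasing
  -- listing (w.r.t. the enumeration order).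
  Ptilde : ℕ → Carrier → ℕ
  Ptilde j z = length (filterᵇ (λ v → nonDecr v ∧ allNonzero v ∧ sumIs z v) (allVecs size j))

  -- N(k,b,F_q^*): number of k-element subsets of F_q^* summing to b.
  -- A k-subset is encoded uniquely by its strictly increasing listing.
  N : ℕ → Carrier → ℕ
  N k b = length (filterᵇ (λ v → strictIncr v ∧ allNonzero v ∧ sumIs b v) (allVecs size k))

sumFrom1 : ℕ → (ℕ → ℤ) → ℤ
sumFrom1 zero    f = + 0
sumFrom1 (suc n) f = sumFrom1 n f ℤ.+ f (suc n)

module Submission where

-- In ℕ[𝔽_q][[t]] put E(t) = ∏_{a ≠ 0} (1 + t·xᵃ) and H(t) = ∏_{a ≠ 0} (1 - t·xᵃ)⁻¹, so that the coefficient of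
-- tᵏxᶻ is N(k,z,𝔽_q^*) in E and P̃_k(z) in H. Since E(-t) H(t) = 1, for m ≥ 1 the coefficient of tᵐx⁰ in
-- E(-t) H(t), namely Σ_k (-1)ᵏ Σ_y N(k,y) P̃_{m-k}(-y), vanishes. Multiplication by a nonzero scalar permutes
-- 𝔽_q^*, so both counts only depend on whether their argument is zero, and the inner sum is
-- N(k,0) P̃_{m-k}(0) + (q-1) N(k,1) P̃_{m-k}(1). The terms k = 0, m-1, m simplify since N₀, P̃₀ and P̃₁ are
-- explicit, which gives the formula. Counting sorted tuples by their first entry shows that N and P̃ are the
-- coefficients of these products built one factor at a time; each factor preserves E(-t) H(t) = 1, and dilation
-- invariance holds because a product does not depend on the order of its factors.

open import Level using (_⊔_)
open import Function using (_∘_; id)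
open import Function.Bundles using (_⇔_; mk⇔; module Equivalence)
open import Data.Bool using (Bool; true; false; _∧_; not; if_then_else_)
open import Data.Bool.Properties using (∧-assoc; ∧-zeroʳ; ∧-identityʳ; ∧-inverseˡ; ∨-∧-commutativeSemiring)
open import Data.Nat as ℕ using (ℕ; zero; suc; _+_; _∸_; _<_; s≤s; _≤ᵇ_; _<ᵇ_)
open import Data.Integer as ℤ using (ℤ; +_; -_; -1ℤ; _*_; _^_) renaming (_+_ to _+ℤ_; _-_ to _-ℤ_)
import Data.Integer.Properties as ℤ
import Data.Nat.Properties as ℕ
open import Data.Nat.ListAction using (sum)
open import Data.Nat.ListAction.Properties using (sum-++; sum-↭)
open import Data.Fin using (Fin; toℕ; zero; suc)
import Data.Fin.Properties as Finₚ
open import Data.Vec as Vec using (Vec; []; _∷_)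
open import Data.List as List using (List; []; _∷_; length; filterᵇ; concatMap; allFin; _++_)
open import Data.List.Properties using (map-∘; map-cong; map-++; map-tabulate; length-map; length-tabulate)
open import Data.List.Relation.Binary.Permutation.Propositional as ↭ using (_↭_)
open import Data.List.Relation.Binary.BagAndSetEquality using (∼bag⇒↭)
open import Data.List.Membership.Propositional using (_∈_)
open import Data.List.Membership.Propositional.Properties using (∈-allFin; ∈-map⁺)
open import Data.List.Membership.Propositional.Properties.WithK using (unique∧set⇒bag)
import Data.List.Relation.Unary.Unique.Propositional.Properties as Unique
import Data.List.Relation.Binary.Permutation.Propositional.Properties as ↭
open import Relation.Nullary using (does; yes; no; ¬_)
open import Relation.Binary.Core using (_Preserves_⟶_)
open import Data.Product using (Σ; _×_; _,_; proj₁; proj₂)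
open import Relation.Nullary.Decidable using (does-⇔; dec-true; dec-false)
open import Relation.Binary.PropositionalEquality using (_≡_; refl; sym; trans; cong; cong₂; subst; module ≡-Reasoning)
open import Defs

import Algebra.Properties.CommutativeSemigroup ℕ.+-commutativeSemigroup as +-CS
import Algebra.Properties.CommutativeSemigroup as CommutativeSemigroupProperties
open import Algebra.Bundles using (module CommutativeSemiring)
import Algebra.Properties.CommutativeSemigroup (CommutativeSemiring.*-commutativeSemigroup ∨-∧-commutativeSemiring) as ∧-CS
import Algebra.Properties.AbelianGroup as AbelianGroupProperties
import Algebra.Properties.Ring as RingProperties
import Relation.Binary.Reasoning.Setoid as SetoidReasoning

infixr 8 [_]·_
[_]·_ : Bool → ℕ → ℕ
[ true  ]· n = n
[ false ]· n = 0

[]·-exchange : ∀ p q X U V W → X + [ q ]· U + [ p ]· (V + [ q ]· W) ≡ X + [ p ]· V + [ q ]· (U + [ p ]· W)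
[]·-exchange true  true  X U V W = +-CS.interchange X U V W
[]·-exchange true  false X U V W = trans (cong₂ _+_ (ℕ.+-identityʳ X) (ℕ.+-identityʳ V)) (sym (ℕ.+-identityʳ (X + V)))
[]·-exchange false true  X U V W = trans (ℕ.+-identityʳ (X + U)) (sym (cong₂ _+_ (ℕ.+-identityʳ X) (ℕ.+-identityʳ U)))
[]·-exchange false false X U V W = refl

∑ : ∀ {a} {A : Set a} → List A → (A → ℕ) → ℕ
∑ xs f = sum (List.map f xs)

infix 5 ∑
syntax ∑ xs (λ x → e) = ∑[ x ∈ xs ] e

count : ∀ {a} {A : Set a} → (A → Bool) → List A → ℕ
count p xs = ∑[ x ∈ xs ] [ p x ]· 1

module _ {a} {A : Set a} where

  ∑-cong : ∀ {f g : A → ℕ} → (∀ x → f x ≡ g x) → ∀ xs → ∑ xs f ≡ ∑ xs g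
  ∑-cong f≗g xs = cong sum (map-cong f≗g xs)

  ∑-map : ∀ {b} {B : Set b} (f : B → ℕ) (g : A → B) xs → ∑ (List.map g xs) f ≡ ∑ xs (f ∘ g)
  ∑-map f g xs = cong sum (sym (map-∘ xs))

  ∑-concatMap : ∀ {b} {B : Set b} (f : B → ℕ) (g : A → List B) xs →
                ∑ (concatMap g xs) f ≡ ∑[ x ∈ xs ] ∑ (g x) f
  ∑-concatMap f g []       = refl
  ∑-concatMap f g (x ∷ xs) = begin
    sum (List.map f (g x ++ concatMap g xs))          ≡⟨ cong sum (map-++ f (g x) _) ⟩
    sum (List.map f (g x) ++ List.map f (concatMap g xs)) ≡⟨ sum-++ (List.map f (g x)) _ ⟩
    ∑ (g x) f + ∑ (concatMap g xs) f                  ≡⟨ cong₂ _+_ refl (∑-concatMap f g xs) ⟩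
    ∑ (g x) f + (∑[ y ∈ xs ] ∑ (g y) f)               ∎
    where open ≡-Reasoning

  ∑-+ : ∀ (f g : A → ℕ) xs → ∑[ x ∈ xs ] (f x + g x) ≡ ∑ xs f + ∑ xs g
  ∑-+ f g []       = refl
  ∑-+ f g (x ∷ xs) = trans (cong₂ _+_ refl (∑-+ f g xs)) (+-CS.interchange (f x) (g x) (∑ xs f) (∑ xs g))

  ∑-zero : ∀ xs → ∑ xs (λ (_ : A) → 0) ≡ 0
  ∑-zero []       = refl
  ∑-zero (_ ∷ xs) = ∑-zero xs

  ∑-↭ : ∀ (f : A → ℕ) {xs ys} → xs ↭ ys → ∑ xs f ≡ ∑ ys f
  ∑-↭ f xs↭ys = sum-↭ (↭.map⁺ f xs↭ys)

  ∑-if : ∀ (p : A → Bool) X Y xs →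
         ∑[ x ∈ xs ] (if p x then X else Y) ≡ count p xs ℕ.* X + count (not ∘ p) xs ℕ.* Y
  ∑-if p X Y []       = refl
  ∑-if p X Y (x ∷ xs) with p x
  ... | true  = trans (cong₂ _+_ refl (∑-if p X Y xs)) (sym (ℕ.+-assoc X _ _))
  ... | false = trans (cong₂ _+_ refl (∑-if p X Y xs)) (+-CS.x∙yz≈y∙xz Y (count p xs ℕ.* X) (count (not ∘ p) xs ℕ.* Y))

  count-cong : ∀ {p q : A → Bool} → (∀ x → p x ≡ q x) → ∀ xs → count p xs ≡ count q xs
  count-cong p≗q = ∑-cong (λ x → cong ([_]· 1) (p≗q x))

  count-∧ˡ : ∀ b (p : A → Bool) xs → count (λ x → b ∧ p x) xs ≡ [ b ]· count p xs
  count-∧ˡ true  p xs = refl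
  count-∧ˡ false p xs = ∑-zero xs

  count-+-count-not : ∀ (p : A → Bool) xs → count p xs + count (not ∘ p) xs ≡ length xs
  count-+-count-not p []       = refl
  count-+-count-not p (x ∷ xs) with p x
  ... | true  = cong suc (count-+-count-not p xs)
  ... | false = trans (ℕ.+-suc (count p xs) _) (cong suc (count-+-count-not p xs))

  length-filterᵇ : ∀ (p : A → Bool) xs → length (filterᵇ p xs) ≡ count p xs
  length-filterᵇ p []       = refl
  length-filterᵇ p (x ∷ xs) with p x
  ... | true  = cong suc (length-filterᵇ p xs)
  ... | false = length-filterᵇ p xs

allFin-suc : ∀ n → allFin (suc n) ≡ zero ∷ List.map suc (allFin n)
allFin-suc n = cong (zero ∷_) (sym (map-tabulate id suc))

count-≟-allFin : ∀ n (i₀ : Fin n) → count (λ i → does (i Finₚ.≟ i₀)) (allFin n) ≡ 1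
count-≟-allFin (suc n) i₀ = begin
  count (λ i → does (i Finₚ.≟ i₀)) (allFin (suc n))
    ≡⟨ cong (count (λ i → does (i Finₚ.≟ i₀))) (allFin-suc n) ⟩
  [ does (zero Finₚ.≟ i₀) ]· 1 + count (λ i → does (i Finₚ.≟ i₀)) (List.map suc (allFin n))
    ≡⟨ cong₂ _+_ refl (∑-map (λ i → [ does (i Finₚ.≟ i₀) ]· 1) suc (allFin n)) ⟩
  [ does (zero Finₚ.≟ i₀) ]· 1 + count (λ j → does (suc j Finₚ.≟ i₀)) (allFin n)
    ≡⟨ at i₀ ⟩
  1 ∎
  where
  open ≡-Reasoning
  at : ∀ i₀ → [ does (zero Finₚ.≟ i₀) ]· 1 + count (λ j → does (suc j Finₚ.≟ i₀)) (allFin n) ≡ 1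
  at zero     = cong suc (∑-zero (allFin n))
  at (suc i₀) = count-≟-allFin n i₀

avoidsZero : ∀ {n k} → Vec (Fin (suc n)) k → Bool
avoidsZero []          = true
avoidsZero (zero  ∷ v) = false
avoidsZero (suc _ ∷ v) = avoidsZero v

count-allVecs-suc : ∀ {n} k (p : Vec (Fin n) (suc k) → Bool) →
                    count p (allVecs n (suc k)) ≡ ∑[ i ∈ allFin n ] count (p ∘ (i ∷_)) (allVecs n k)
count-allVecs-suc {n} k p = trans (∑-concatMap _ _ (allFin n))
  (∑-cong (λ i → ∑-map (λ v → [ p v ]· 1) (i ∷_) (allVecs n k)) (allFin n))

count-allVecs-split : ∀ {n} k (p : Vec (Fin (suc n)) (suc k) → Bool) →
  count p (allVecs (suc n) (suc k))
    ≡ count (p ∘ (zero ∷_)) (allVecs (suc n) k) + (∑[ j ∈ allFin n ] count (p ∘ (suc j ∷_)) (allVecs (suc n) k))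
count-allVecs-split {n} k p = begin
  count p (allVecs (suc n) (suc k))
    ≡⟨ count-allVecs-suc k p ⟩
  ∑[ i ∈ allFin (suc n) ] count (p ∘ (i ∷_)) (allVecs (suc n) k)
    ≡⟨ cong (λ is → ∑[ i ∈ is ] count (p ∘ (i ∷_)) (allVecs (suc n) k)) (allFin-suc n) ⟩
  count (p ∘ (zero ∷_)) (allVecs (suc n) k) + ∑ (List.map suc (allFin n)) (λ i → count (p ∘ (i ∷_)) (allVecs (suc n) k))
    ≡⟨ cong₂ _+_ refl (∑-map _ suc (allFin n)) ⟩
  count (p ∘ (zero ∷_)) (allVecs (suc n) k) + (∑[ j ∈ allFin n ] count (p ∘ (suc j ∷_)) (allVecs (suc n) k))
    ∎
  where open ≡-Reasoning

count-avoidsZero : ∀ {n} k (p : Vec (Fin (suc n)) k → Bool) →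
  count (λ v → avoidsZero v ∧ p v) (allVecs (suc n) k) ≡ count (p ∘ Vec.map suc) (allVecs n k)
count-avoidsZero         zero    p = refl
count-avoidsZero {n} (suc k) p = begin
  count q (allVecs (suc n) (suc k))
    ≡⟨ count-allVecs-split k q ⟩
  count (λ v → false ∧ p (zero ∷ v)) (allVecs (suc n) k) + (∑[ j ∈ allFin n ] count (q ∘ (suc j ∷_)) (allVecs (suc n) k))
    ≡⟨ cong₂ _+_ (count-∧ˡ false (p ∘ (zero ∷_)) (allVecs (suc n) k))
                 (∑-cong (λ j → count-avoidsZero k (p ∘ (suc j ∷_))) (allFin n)) ⟩
  ∑[ j ∈ allFin n ] count (p ∘ Vec.map suc ∘ (j ∷_)) (allVecs n k)
    ≡⟨ count-allVecs-suc k (p ∘ Vec.map suc) ⟨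
  count (p ∘ Vec.map suc) (allVecs n (suc k))
    ∎
  where
  open ≡-Reasoning
  q : Vec (Fin (suc n)) (suc k) → Bool
  q v = avoidsZero v ∧ p v

count-byHead : ∀ {n} k (p : Vec (Fin (suc n)) (suc k) → Bool) →
  (∀ j v → p (suc j ∷ v) ≡ avoidsZero v ∧ p (suc j ∷ v)) →
  count p (allVecs (suc n) (suc k)) ≡ count (p ∘ (zero ∷_)) (allVecs (suc n) k) + count (p ∘ Vec.map suc) (allVecs n (suc k))
count-byHead {n} k p tail-avoidsZero = begin
  count p (allVecs (suc n) (suc k))
    ≡⟨ count-allVecs-split k p ⟩
  count (p ∘ (zero ∷_)) (allVecs (suc n) k) + (∑[ j ∈ allFin n ] count (p ∘ (suc j ∷_)) (allVecs (suc n) k))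
    ≡⟨ cong₂ _+_ refl (∑-cong suc-head (allFin n)) ⟩
  count (p ∘ (zero ∷_)) (allVecs (suc n) k) + (∑[ j ∈ allFin n ] count (p ∘ Vec.map suc ∘ (j ∷_)) (allVecs n k))
    ≡⟨ cong₂ _+_ refl (count-allVecs-suc k (p ∘ Vec.map suc)) ⟨
  count (p ∘ (zero ∷_)) (allVecs (suc n) k) + count (p ∘ Vec.map suc) (allVecs n (suc k))
    ∎
  where
  open ≡-Reasoning
  suc-head : ∀ j → count (p ∘ (suc j ∷_)) (allVecs (suc n) k) ≡ count (p ∘ Vec.map suc ∘ (j ∷_)) (allVecs n k)
  suc-head j = trans (∑-cong (λ v → cong ([_]· 1) (tail-avoidsZero j v)) (allVecs (suc n) k))
                     (count-avoidsZero k (p ∘ (suc j ∷_)))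

module _ {n : ℕ} where

  nonDecr-suc∷ : ∀ {k} (j : Fin n) (v : Vec (Fin (suc n)) k) → nonDecr (suc j ∷ v) ≡ avoidsZero v ∧ nonDecr (suc j ∷ v)
  nonDecr-suc∷ j []          = refl
  nonDecr-suc∷ j (zero  ∷ v) = refl
  nonDecr-suc∷ j (suc i ∷ v) =
    trans (cong (_ ∧_) (nonDecr-suc∷ i v)) (∧-CS.x∙yz≈y∙xz (toℕ j <ᵇ suc (toℕ i)) (avoidsZero v) (nonDecr (suc i ∷ v)))

  strictIncr-suc∷ : ∀ {k} (j : Fin n) (v : Vec (Fin (suc n)) k) → strictIncr (suc j ∷ v) ≡ avoidsZero v ∧ strictIncr (suc j ∷ v)
  strictIncr-suc∷ j []          = refl
  strictIncr-suc∷ j (zero  ∷ v) = refl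
  strictIncr-suc∷ j (suc i ∷ v) =
    trans (cong (_ ∧_) (strictIncr-suc∷ i v)) (∧-CS.x∙yz≈y∙xz (toℕ j <ᵇ toℕ i) (avoidsZero v) (strictIncr (suc i ∷ v)))

  nonDecr-zero∷ : ∀ {k} (v : Vec (Fin (suc n)) k) → nonDecr (zero ∷ v) ≡ nonDecr v
  nonDecr-zero∷ []      = refl
  nonDecr-zero∷ (_ ∷ _) = refl

  strictIncr-zero∷ : ∀ {k} (v : Vec (Fin (suc n)) k) → strictIncr (zero ∷ v) ≡ avoidsZero v ∧ strictIncr v
  strictIncr-zero∷ []          = refl
  strictIncr-zero∷ (zero  ∷ v) = refl
  strictIncr-zero∷ (suc i ∷ v) = strictIncr-suc∷ i v

  nonDecr-map-suc : ∀ {k} (v : Vec (Fin n) k) → nonDecr (Vec.map suc v) ≡ nonDecr v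
  nonDecr-map-suc []          = refl
  nonDecr-map-suc (_ ∷ [])    = refl
  nonDecr-map-suc (x ∷ y ∷ v) = cong₂ _∧_ (suc<ᵇsuc (toℕ x) (toℕ y)) (nonDecr-map-suc (y ∷ v))
    where
    suc<ᵇsuc : ∀ a b → (a <ᵇ suc b) ≡ (a ≤ᵇ b)
    suc<ᵇsuc zero    b = refl
    suc<ᵇsuc (suc a) b = refl

  strictIncr-map-suc : ∀ {k} (v : Vec (Fin n) k) → strictIncr (Vec.map suc v) ≡ strictIncr v
  strictIncr-map-suc []          = refl
  strictIncr-map-suc (_ ∷ [])    = refl
  strictIncr-map-suc (x ∷ y ∷ v) = cong (_ ∧_) (strictIncr-map-suc (y ∷ v))

-- If f k l is the coefficient of sᵏtˡ in F(s,t), then alternating f m is the coefficient of tᵐ in F(-t,t).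
alternating : (ℕ → ℕ → ℕ) → ℕ → ℤ
alternating f zero    = + f 0 0
alternating f (suc m) = + f 0 (suc m) -ℤ alternating (f ∘ suc) m

alternating-cong : ∀ {f g : ℕ → ℕ → ℕ} → (∀ k l → f k l ≡ g k l) → ∀ m → alternating f m ≡ alternating g m
alternating-cong f≗g zero    = cong +_ (f≗g 0 0)
alternating-cong f≗g (suc m) = cong₂ _-ℤ_ (cong +_ (f≗g 0 (suc m))) (alternating-cong (f≗g ∘ suc) m)

alternating-zero : ∀ {f : ℕ → ℕ → ℕ} → (∀ k l → f k l ≡ 0) → ∀ m → alternating f m ≡ + 0
alternating-zero f≗0 m = trans (alternating-cong f≗0 m) (vanish m)
  where
  vanish : ∀ m → alternating (λ _ _ → 0) m ≡ + 0
  vanish zero    = refl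
  vanish (suc m) = cong (+ 0 -ℤ_) (vanish m)

module _ where
  open import Data.Integer.Solver using (module +-*-Solver)
  open +-*-Solver

  [a+b]-[c+d]≡[a-c]+[b-d] : ∀ a b c d → (a +ℤ b) -ℤ (c +ℤ d) ≡ (a -ℤ c) +ℤ (b -ℤ d)
  [a+b]-[c+d]≡[a-c]+[b-d] = solve 4 (λ a b c d → (a :+ b) :- (c :+ d) := (a :- c) :+ (b :- d)) refl

  [a+b]-c≡[a-c]+b : ∀ a b c → (a +ℤ b) -ℤ c ≡ (a -ℤ c) +ℤ b
  [a+b]-c≡[a-c]+b = solve 3 (λ a b c → (a :+ b) :- c := (a :- c) :+ b) refl

  a-[b+c]≡[a-b]-c : ∀ a b c → a -ℤ (b +ℤ c) ≡ (a -ℤ b) -ℤ c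
  a-[b+c]≡[a-b]-c = solve 3 (λ a b c → a :- (b :+ c) := (a :- b) :- c) refl

  alternating-+ : ∀ (f g : ℕ → ℕ → ℕ) m → alternating (λ k l → f k l + g k l) m ≡ alternating f m +ℤ alternating g m
  alternating-+ f g zero    = ℤ.pos-+ (f 0 0) (g 0 0)
  alternating-+ f g (suc m) = begin
    + (f 0 (suc m) + g 0 (suc m)) -ℤ alternating (λ k l → f (suc k) l + g (suc k) l) m
      ≡⟨ cong₂ _-ℤ_ (ℤ.pos-+ (f 0 (suc m)) (g 0 (suc m))) (alternating-+ (f ∘ suc) (g ∘ suc) m) ⟩
    (+ f 0 (suc m) +ℤ + g 0 (suc m)) -ℤ (alternating (f ∘ suc) m +ℤ alternating (g ∘ suc) m)
      ≡⟨ [a+b]-[c+d]≡[a-c]+[b-d] (+ f 0 (suc m)) (+ g 0 (suc m)) (alternating (f ∘ suc) m) (alternating (g ∘ suc) m) ⟩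
    (+ f 0 (suc m) -ℤ alternating (f ∘ suc) m) +ℤ (+ g 0 (suc m) -ℤ alternating (g ∘ suc) m)
      ∎
    where open ≡-Reasoning

  -- F = G + t·H
  alternating-split₂ : ∀ (f g h : ℕ → ℕ → ℕ) →
                       (∀ k → f k 0 ≡ g k 0) → (∀ k l → f k (suc l) ≡ g k (suc l) + h k l) → ∀ m → alternating f (suc m) ≡ alternating g (suc m) +ℤ alternating h m
  alternating-split₂ f g h f₀ f₊ zero = begin
    + f 0 1 -ℤ + f 1 0
      ≡⟨ cong₂ _-ℤ_ (trans (cong +_ (f₊ 0 0)) (ℤ.pos-+ (g 0 1) (h 0 0))) (cong +_ (f₀ 1)) ⟩
    (+ g 0 1 +ℤ + h 0 0) -ℤ + g 1 0
      ≡⟨ [a+b]-c≡[a-c]+b (+ g 0 1) (+ h 0 0) (+ g 1 0) ⟩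
    (+ g 0 1 -ℤ + g 1 0) +ℤ + h 0 0
      ∎
    where open ≡-Reasoning
  alternating-split₂ f g h f₀ f₊ (suc m) = begin
    + f 0 (suc (suc m)) -ℤ alternating (f ∘ suc) (suc m)
      ≡⟨ cong₂ _-ℤ_ (trans (cong +_ (f₊ 0 (suc m))) (ℤ.pos-+ (g 0 (suc (suc m))) (h 0 (suc m))))
                    (alternating-split₂ (f ∘ suc) (g ∘ suc) (h ∘ suc) (f₀ ∘ suc) (f₊ ∘ suc) m) ⟩
    (+ g 0 (suc (suc m)) +ℤ + h 0 (suc m)) -ℤ (alternating (g ∘ suc) (suc m) +ℤ alternating (h ∘ suc) m)
      ≡⟨ [a+b]-[c+d]≡[a-c]+[b-d] (+ g 0 (suc (suc m))) (+ h 0 (suc m)) (alternating (g ∘ suc) (suc m)) (alternating (h ∘ suc) m) ⟩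
    (+ g 0 (suc (suc m)) -ℤ alternating (g ∘ suc) (suc m)) +ℤ (+ h 0 (suc m) -ℤ alternating (h ∘ suc) m)
      ∎
    where open ≡-Reasoning

  -- F = G + s·H
  alternating-split₁ : ∀ (f g h : ℕ → ℕ → ℕ) →
                       (∀ l → f 0 l ≡ g 0 l) → (∀ k l → f (suc k) l ≡ g (suc k) l + h k l) → ∀ m → alternating f (suc m) ≡ alternating g (suc m) -ℤ alternating h m
  alternating-split₁ f g h f₀ f₊ m = begin
    + f 0 (suc m) -ℤ alternating (f ∘ suc) m
      ≡⟨ cong₂ _-ℤ_ (cong +_ (f₀ (suc m))) (trans (alternating-cong f₊ m) (alternating-+ (g ∘ suc) h m)) ⟩
    + g 0 (suc m) -ℤ (alternating (g ∘ suc) m +ℤ alternating h m)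
      ≡⟨ a-[b+c]≡[a-b]-c (+ g 0 (suc m)) (alternating (g ∘ suc) m) (alternating h m) ⟩
    (+ g 0 (suc m) -ℤ alternating (g ∘ suc) m) -ℤ alternating h m
      ∎
    where open ≡-Reasoning

-1^[1+k]*x≡-[-1^k*x] : ∀ k x → -1ℤ ^ suc k * x ≡ - (-1ℤ ^ k * x)
-1^[1+k]*x≡-[-1^k*x] k x = trans (ℤ.*-assoc -1ℤ (-1ℤ ^ k) x) (ℤ.-1*i≡-i (-1ℤ ^ k * x))

sumFrom1-cong : ∀ {f g : ℕ → ℤ} → (∀ k → f k ≡ g k) → ∀ m → sumFrom1 m f ≡ sumFrom1 m g
sumFrom1-cong f≗g zero    = refl
sumFrom1-cong f≗g (suc m) = cong₂ _+ℤ_ (sumFrom1-cong f≗g m) (f≗g (suc m))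

sumFrom1-neg : ∀ (f : ℕ → ℤ) m → sumFrom1 m (λ k → - f k) ≡ - sumFrom1 m f
sumFrom1-neg f zero    = refl
sumFrom1-neg f (suc m) = trans (cong (_+ℤ - f (suc m)) (sumFrom1-neg f m)) (sym (ℤ.neg-distrib-+ (sumFrom1 m f) (f (suc m))))

sumFrom1-suc : ∀ (f : ℕ → ℤ) m → sumFrom1 (suc m) f ≡ f 1 +ℤ sumFrom1 m (f ∘ suc)
sumFrom1-suc f zero    = ℤ.+-comm (+ 0) (f 1)
sumFrom1-suc f (suc m) = trans (cong (_+ℤ f (suc (suc m))) (sumFrom1-suc f m))
                               (ℤ.+-assoc (f 1) (sumFrom1 m (f ∘ suc)) (f (suc (suc m))))

alternating≡sumFrom1 : ∀ f m → alternating f m ≡ + f 0 m +ℤ sumFrom1 m (λ k → -1ℤ ^ k * + f k (m ∸ k))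
alternating≡sumFrom1 f zero    = sym (ℤ.+-identityʳ (+ f 0 0))
alternating≡sumFrom1 f (suc m) = begin
  + f 0 (suc m) -ℤ alternating (f ∘ suc) m
    ≡⟨ cong (λ t → + f 0 (suc m) -ℤ t) (alternating≡sumFrom1 (f ∘ suc) m) ⟩
  + f 0 (suc m) -ℤ (+ f 1 m +ℤ sumFrom1 m (λ k → -1ℤ ^ k * + f (suc k) (m ∸ k)))
    ≡⟨ cong (+ f 0 (suc m) +ℤ_) (ℤ.neg-distrib-+ (+ f 1 m) _) ⟩
  + f 0 (suc m) +ℤ (- + f 1 m +ℤ - sumFrom1 m (λ k → -1ℤ ^ k * + f (suc k) (m ∸ k)))
    ≡⟨ cong (+ f 0 (suc m) +ℤ_) (cong₂ _+ℤ_ first rest) ⟨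
  + f 0 (suc m) +ℤ (g 1 +ℤ sumFrom1 m (g ∘ suc))
    ≡⟨ cong (+ f 0 (suc m) +ℤ_) (sumFrom1-suc g m) ⟨
  + f 0 (suc m) +ℤ sumFrom1 (suc m) g
    ∎
  where
  open ≡-Reasoning
  g : ℕ → ℤ
  g k = -1ℤ ^ k * + f k (suc m ∸ k)
  first : g 1 ≡ - + f 1 m
  first = trans (-1^[1+k]*x≡-[-1^k*x] 0 (+ f 1 m)) (cong -_ (ℤ.*-identityˡ (+ f 1 m)))
  rest : sumFrom1 m (g ∘ suc) ≡ - sumFrom1 m (λ k → -1ℤ ^ k * + f (suc k) (m ∸ k))
  rest = trans (sumFrom1-cong (λ k → -1^[1+k]*x≡-[-1^k*x] k _) m) (sumFrom1-neg _ m)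

module _ {c ℓ} (F : FiniteField c ℓ) where

  open FiniteField F using (Carrier; _≈_; 0#; 1#; _≟_; size; enum; enum-inj; enum-surj; inverse; 1≉0)
    renaming (_+_ to _+ᶠ_; _*_ to _*ᶠ_; -_ to -ᶠ_; _-_ to _-ᶠ_)
  private
    module R = FiniteField F
  open AbelianGroupProperties R.+-abelianGroup using (//-rightDividesˡ; //-rightDividesʳ; ⁻¹-∙-comm; x∙y⁻¹≈ε⇒x≈y)
  open CommutativeSemigroupProperties R.+-commutativeSemigroup using (xy∙z≈xz∙y)
  open RingProperties R.ring using (x[y-z]≈xy-xz)

  [x-a]-b≈[x-b]-a : ∀ x a b → x -ᶠ a -ᶠ b ≈ x -ᶠ b -ᶠ a
  [x-a]-b≈[x-b]-a x a b = xy∙z≈xz∙y x (-ᶠ a) (-ᶠ b)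

  x-[y+a]≈[x-a]-y : ∀ x y a → x -ᶠ (y +ᶠ a) ≈ x -ᶠ a -ᶠ y
  x-[y+a]≈[x-a]-y x y a = R.trans (R.+-congˡ (R.sym (⁻¹-∙-comm y a)))
                         (R.trans (R.sym (R.+-assoc x (-ᶠ y) (-ᶠ a))) ([x-a]-b≈[x-b]-a x y a))

  a+s≈z⇔s≈z-a : ∀ a s z → (a +ᶠ s ≈ z) ⇔ (s ≈ z -ᶠ a)
  a+s≈z⇔s≈z-a a s z = mk⇔
    (λ a+s≈z → R.trans (R.sym (//-rightDividesʳ a s)) (R.+-congʳ (R.trans (R.+-comm s a) a+s≈z)))
    (λ s≈z-a → R.trans (R.+-comm a s) (R.trans (R.+-congʳ s≈z-a) (//-rightDividesˡ a z)))

  0-x≈0⇒x≈0 : ∀ x → 0# -ᶠ x ≈ 0# → x ≈ 0#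
  0-x≈0⇒x≈0 x 0-x≈0 = R.sym (x∙y⁻¹≈ε⇒x≈y 0# x 0-x≈0)

  s*w≈0⇒w≈0 : ∀ {s} w → ¬ s ≈ 0# → s *ᶠ w ≈ 0# → w ≈ 0#
  s*w≈0⇒w≈0 {s} w s≉0 sw≈0 with inverse s s≉0
  ... | t , st≈1 = begin
    w              ≈⟨ R.*-identityˡ w ⟨
    1# *ᶠ w        ≈⟨ R.*-congʳ (R.trans (R.sym st≈1) (R.*-comm s t)) ⟩
    (t *ᶠ s) *ᶠ w  ≈⟨ R.*-assoc t s w ⟩
    t *ᶠ (s *ᶠ w)  ≈⟨ R.*-congˡ sw≈0 ⟩
    t *ᶠ 0#        ≈⟨ R.zeroʳ t ⟩
    0#             ∎
    where open SetoidReasoning R.setoid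

  nonzero : Carrier → Bool
  nonzero w = not (does (w ≟ 0#))

  nonzero-cong : ∀ {w w′} → w ≈ w′ → nonzero w ≡ nonzero w′
  nonzero-cong w≈w′ = cong not (does-⇔ (mk⇔ (R.trans (R.sym w≈w′)) (R.trans w≈w′)) (_ ≟ 0#) (_ ≟ 0#))

  nonzero-* : ∀ {s} w → ¬ s ≈ 0# → nonzero (s *ᶠ w) ≡ nonzero w
  nonzero-* {s} w s≉0 =
    cong not (does-⇔ (mk⇔ (s*w≈0⇒w≈0 w s≉0) (λ w≈0 → R.trans (R.*-congˡ w≈0) (R.zeroʳ s))) (_ ≟ 0#) (_ ≟ 0#))

  -- A series f is read as Σ f k z tᵏ xᶻ, a power series in t over the group ring ℕ[(Carrier, +)].
  Series : Set c
  Series = ℕ → Carrier → ℕ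

  infix 4 _≋_
  _≋_ : Series → Series → Set c
  f ≋ g = ∀ k z → f k z ≡ g k z

  Congruent : Series → Set (c ⊔ ℓ)
  Congruent f = ∀ k → f k Preserves _≈_ ⟶ _≡_

  one : Series
  one zero    z = [ does (0# ≟ z) ]· 1
  one (suc k) z = 0

  one-congruent : Congruent one
  one-congruent zero    z≈z′ =
    cong ([_]· 1) (does-⇔ (mk⇔ (λ 0≈z → R.trans 0≈z z≈z′) (λ 0≈z′ → R.trans 0≈z′ (R.sym z≈z′)))
                          (0# ≟ _) (0# ≟ _))
  one-congruent (suc k) _    = refl

  -- Multiplication by 1 + t·xʷ (the identity if w ≈ 0).
  extendSubsets : Carrier → Series → Series
  extendSubsets w f zero    z = f zero z
  extendSubsets w f (suc k) z = f (suc k) z + [ nonzero w ]· f k (z -ᶠ w)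

  -- Division by 1 - t·xʷ (the identity if w ≈ 0).
  extendMultisets : Carrier → Series → Series
  extendMultisets w f zero    z = f zero z
  extendMultisets w f (suc k) z = f (suc k) z + [ nonzero w ]· extendMultisets w f k (z -ᶠ w)

  record IsExtension (extend : Carrier → Series → Series) : Set (c ⊔ ℓ) where
    field
      zero-coefficient : ∀ w f z → extend w f zero z ≡ f zero z
      ≋-cong           : ∀ w {f g} → f ≋ g → extend w f ≋ extend w g
      preserves-congruent : ∀ w {f} → Congruent f → Congruent (extend w f)
      comm             : ∀ a b {f} → Congruent f → extend a (extend b f) ≋ extend b (extend a f)
      dilation         : ∀ {s w w′ f f′} → ¬ s ≈ 0# → w′ ≈ s *ᶠ w → Congruent f′ →
                         (∀ k z → f′ k (s *ᶠ z) ≡ f k z) → ∀ k z → extend w′ f′ k (s *ᶠ z) ≡ extend w f k z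

  private
    s*z-w′≈s*[z-w] : ∀ {s w w′} z → w′ ≈ s *ᶠ w → s *ᶠ z -ᶠ w′ ≈ s *ᶠ (z -ᶠ w)
    s*z-w′≈s*[z-w] {s} {w} z w′≈sw = R.trans (R.+-congˡ (R.-‿cong w′≈sw)) (R.sym (x[y-z]≈xy-xz s z w))

    nonzero-dilation : ∀ {s w w′} → ¬ s ≈ 0# → w′ ≈ s *ᶠ w → nonzero w′ ≡ nonzero w
    nonzero-dilation {w = w} s≉0 w′≈sw = trans (nonzero-cong w′≈sw) (nonzero-* w s≉0)

  module Subsets where

    ≋-cong : ∀ w {f g} → f ≋ g → extendSubsets w f ≋ extendSubsets w g
    ≋-cong w f≋g zero    z = f≋g zero z
    ≋-cong w f≋g (suc k) z = cong₂ _+_ (f≋g (suc k) z) (cong ([ nonzero w ]·_) (f≋g k (z -ᶠ w)))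

    preserves-congruent : ∀ w {f} → Congruent f → Congruent (extendSubsets w f)
    preserves-congruent w f-cong zero    z≈z′ = f-cong zero z≈z′
    preserves-congruent w f-cong (suc k) z≈z′ =
      cong₂ _+_ (f-cong (suc k) z≈z′) (cong ([ nonzero w ]·_) (f-cong k (R.+-congʳ z≈z′)))

    comm : ∀ a b {f} → Congruent f → extendSubsets a (extendSubsets b f) ≋ extendSubsets b (extendSubsets a f)
    comm a b     f-cong zero          z = refl
    comm a b {f} f-cong (suc zero)    z = +-CS.xy∙z≈xz∙y (f 1 z) _ _
    comm a b {f} f-cong (suc (suc k)) z = trans
      ([]·-exchange (nonzero a) (nonzero b) (f (suc (suc k)) z) (f (suc k) (z -ᶠ b)) (f (suc k) (z -ᶠ a)) (f k (z -ᶠ a -ᶠ b)))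
      (cong (λ t → f (suc (suc k)) z + [ nonzero a ]· f (suc k) (z -ᶠ a) + [ nonzero b ]· (f (suc k) (z -ᶠ b) + [ nonzero a ]· t))
            (f-cong k ([x-a]-b≈[x-b]-a z a b)))

    dilation : ∀ {s w w′ f f′} → ¬ s ≈ 0# → w′ ≈ s *ᶠ w → Congruent f′ →
               (∀ k z → f′ k (s *ᶠ z) ≡ f k z) → ∀ k z → extendSubsets w′ f′ k (s *ᶠ z) ≡ extendSubsets w f k z
    dilation s≉0 w′≈sw f′-cong f′∘s≗f zero    z = f′∘s≗f zero z
    dilation s≉0 w′≈sw f′-cong f′∘s≗f (suc k) z = cong₂ _+_ (f′∘s≗f (suc k) z)
      (cong₂ [_]·_ (nonzero-dilation s≉0 w′≈sw) (trans (f′-cong k (s*z-w′≈s*[z-w] z w′≈sw)) (f′∘s≗f k _)))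

  module Multisets where

    ≋-cong : ∀ w {f g} → f ≋ g → extendMultisets w f ≋ extendMultisets w g
    ≋-cong w f≋g zero    z = f≋g zero z
    ≋-cong w f≋g (suc k) z = cong₂ _+_ (f≋g (suc k) z) (cong ([ nonzero w ]·_) (≋-cong w f≋g k (z -ᶠ w)))

    preserves-congruent : ∀ w {f} → Congruent f → Congruent (extendMultisets w f)
    preserves-congruent w f-cong zero    z≈z′ = f-cong zero z≈z′
    preserves-congruent w f-cong (suc k) z≈z′ =
      cong₂ _+_ (f-cong (suc k) z≈z′) (cong ([ nonzero w ]·_) (preserves-congruent w f-cong k (R.+-congʳ z≈z′)))

    comm : ∀ a b {f} → Congruent f → extendMultisets a (extendMultisets b f) ≋ extendMultisets b (extendMultisets a f)
    comm a b     f-cong zero          z = refl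
    comm a b {f} f-cong (suc zero)    z = +-CS.xy∙z≈xz∙y (f 1 z) _ _
    comm a b {f} f-cong (suc (suc k)) z = begin
      X + [ q ]· Bf (suc k) (z -ᶠ b) + [ p ]· AB (suc k) (z -ᶠ a)
        ≡⟨ cong (λ t → X + [ q ]· Bf (suc k) (z -ᶠ b) + [ p ]· t) (comm a b f-cong (suc k) (z -ᶠ a)) ⟩
      X + [ q ]· Bf (suc k) (z -ᶠ b) + [ p ]· (Af (suc k) (z -ᶠ a) + [ q ]· BA k (z -ᶠ a -ᶠ b))
        ≡⟨ cong (λ t → X + [ q ]· Bf (suc k) (z -ᶠ b) + [ p ]· (Af (suc k) (z -ᶠ a) + [ q ]· t)) W≡W′ ⟩
      X + [ q ]· Bf (suc k) (z -ᶠ b) + [ p ]· (Af (suc k) (z -ᶠ a) + [ q ]· AB k (z -ᶠ b -ᶠ a))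
        ≡⟨ []·-exchange p q X _ _ _ ⟩
      X + [ p ]· Af (suc k) (z -ᶠ a) + [ q ]· (Bf (suc k) (z -ᶠ b) + [ p ]· AB k (z -ᶠ b -ᶠ a))
        ≡⟨ cong (λ t → X + [ p ]· Af (suc k) (z -ᶠ a) + [ q ]· t) (comm a b f-cong (suc k) (z -ᶠ b)) ⟩
      X + [ p ]· Af (suc k) (z -ᶠ a) + [ q ]· BA (suc k) (z -ᶠ b)
        ∎
      where
      open ≡-Reasoning
      p = nonzero a
      q = nonzero b
      X = f (suc (suc k)) z
      Af = extendMultisets a f
      Bf = extendMultisets b f
      AB = extendMultisets a Bf
      BA = extendMultisets b Af
      W≡W′ : BA k (z -ᶠ a -ᶠ b) ≡ AB k (z -ᶠ b -ᶠ a)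
      W≡W′ = trans (sym (comm a b f-cong k (z -ᶠ a -ᶠ b)))
                   (preserves-congruent a (preserves-congruent b f-cong) k ([x-a]-b≈[x-b]-a z a b))

    dilation : ∀ {s w w′ f f′} → ¬ s ≈ 0# → w′ ≈ s *ᶠ w → Congruent f′ →
               (∀ k z → f′ k (s *ᶠ z) ≡ f k z) → ∀ k z → extendMultisets w′ f′ k (s *ᶠ z) ≡ extendMultisets w f k z
    dilation s≉0 w′≈sw f′-cong f′∘s≗f zero    z = f′∘s≗f zero z
    dilation {w′ = w′} s≉0 w′≈sw f′-cong f′∘s≗f (suc k) z = cong₂ _+_ (f′∘s≗f (suc k) z)
      (cong₂ [_]·_ (nonzero-dilation s≉0 w′≈sw)
        (trans (preserves-congruent w′ f′-cong k (s*z-w′≈s*[z-w] z w′≈sw)) (dilation s≉0 w′≈sw f′-cong f′∘s≗f k _)))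

  subsets-isExtension : IsExtension extendSubsets
  subsets-isExtension = record
    { zero-coefficient = λ _ _ _ → refl ; ≋-cong = Subsets.≋-cong ; preserves-congruent = Subsets.preserves-congruent
    ; comm = Subsets.comm ; dilation = Subsets.dilation }

  multisets-isExtension : IsExtension extendMultisets
  multisets-isExtension = record
    { zero-coefficient = λ _ _ _ → refl ; ≋-cong = Multisets.≋-cong ; preserves-congruent = Multisets.preserves-congruent
    ; comm = Multisets.comm ; dilation = Multisets.dilation }

  elements : List Carrier
  elements = List.map enum (allFin size)

  bijectionPermutation : (φ ψ : Carrier → Carrier) → φ Preserves _≈_ ⟶ _≈_ → ψ Preserves _≈_ ⟶ _≈_ →
                  (∀ x → ψ (φ x) ≈ x) → (∀ x → φ (ψ x) ≈ x) →
                  Σ (Fin size → Fin size) λ σ → (∀ i → enum (σ i) ≈ φ (enum i)) × (List.map σ (allFin size) ↭ allFin size)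
  bijectionPermutation φ ψ φ-cong ψ-cong ψ∘φ≈id φ∘ψ≈id =
    σ , enum∘σ≈φ∘enum , ∼bag⇒↭ (unique∧set⇒bag unique-σ (Unique.allFin⁺ size) onto)
    where
    σ τ : Fin size → Fin size
    σ i = proj₁ (enum-surj (φ (enum i)))
    τ j = proj₁ (enum-surj (ψ (enum j)))
    enum∘σ≈φ∘enum : ∀ i → enum (σ i) ≈ φ (enum i)
    enum∘σ≈φ∘enum i = proj₂ (enum-surj (φ (enum i)))
    σ-injective : ∀ {i j} → σ i ≡ σ j → i ≡ j
    σ-injective {i} {j} σi≡σj = enum-inj i j (begin
      enum i              ≈⟨ ψ∘φ≈id (enum i) ⟨
      ψ (φ (enum i))      ≈⟨ ψ-cong (R.sym (enum∘σ≈φ∘enum i)) ⟩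
      ψ (enum (σ i))      ≡⟨ cong (ψ ∘ enum) σi≡σj ⟩
      ψ (enum (σ j))      ≈⟨ ψ-cong (enum∘σ≈φ∘enum j) ⟩
      ψ (φ (enum j))      ≈⟨ ψ∘φ≈id (enum j) ⟩
      enum j              ∎)
      where open SetoidReasoning R.setoid
    σ∘τ≡id : ∀ j → σ (τ j) ≡ j
    σ∘τ≡id j = enum-inj (σ (τ j)) j
      (R.trans (enum∘σ≈φ∘enum (τ j)) (R.trans (φ-cong (proj₂ (enum-surj (ψ (enum j))))) (φ∘ψ≈id (enum j))))
    unique-σ = Unique.map⁺ σ-injective (Unique.allFin⁺ size)
    onto : ∀ {j} → (j ∈ List.map σ (allFin size)) ⇔ (j ∈ allFin size)
    onto {j} = mk⇔ (λ _ → ∈-allFin j)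
                   (λ _ → subst (_∈ List.map σ (allFin size)) (σ∘τ≡id j) (∈-map⁺ σ (∈-allFin (τ j))))

  ∑-translation : ∀ a (g : Carrier → ℕ) → g Preserves _≈_ ⟶ _≡_ → ∑ elements g ≡ ∑[ y ∈ elements ] g (y +ᶠ a)
  ∑-translation a g g-cong with bijectionPermutation (_+ᶠ a) (_-ᶠ a) R.+-congʳ R.+-congʳ (//-rightDividesʳ a) (//-rightDividesˡ a)
  ... | σ , enum∘σ≈enum+a , σ-permutes = begin
    ∑ (List.map enum (allFin size)) g                  ≡⟨ ∑-map g enum (allFin size) ⟩
    ∑ (allFin size) (g ∘ enum)                         ≡⟨ ∑-↭ (g ∘ enum) σ-permutes ⟨
    ∑ (List.map σ (allFin size)) (g ∘ enum)            ≡⟨ ∑-map (g ∘ enum) σ (allFin size) ⟩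
    ∑[ i ∈ allFin size ] g (enum (σ i))                ≡⟨ ∑-cong (λ i → g-cong (enum∘σ≈enum+a i)) (allFin size) ⟩
    ∑[ i ∈ allFin size ] g (enum i +ᶠ a)               ≡⟨ ∑-map (λ y → g (y +ᶠ a)) enum (allFin size) ⟨
    ∑[ y ∈ elements ] g (y +ᶠ a)                       ∎
    where open ≡-Reasoning

  dilationPermutation : ∀ {s} → ¬ s ≈ 0# →
    Σ (Fin size → Fin size) λ σ → (∀ i → enum (σ i) ≈ s *ᶠ enum i) × (List.map σ (allFin size) ↭ allFin size)
  dilationPermutation {s} s≉0 with inverse s s≉0
  ... | t , st≈1 = bijectionPermutation (s *ᶠ_) (t *ᶠ_) R.*-congˡ R.*-congˡ
                                        (cancel t s (R.trans (R.*-comm t s) st≈1)) (cancel s t st≈1)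
    where
    cancel : ∀ a b → a *ᶠ b ≈ 1# → ∀ x → a *ᶠ (b *ᶠ x) ≈ x
    cancel a b ab≈1 x = R.trans (R.sym (R.*-assoc a b x)) (R.trans (R.*-congʳ ab≈1) (R.*-identityˡ x))

  one-dilation : ∀ {s} → ¬ s ≈ 0# → ∀ k z → one k (s *ᶠ z) ≡ one k z
  one-dilation {s} s≉0 zero    z = cong ([_]· 1) (does-⇔ (mk⇔ (λ 0≈sz → R.sym (s*w≈0⇒w≈0 z s≉0 (R.sym 0≈sz)))
                                                                (λ 0≈z → R.sym (R.trans (R.*-congˡ (R.sym 0≈z)) (R.zeroʳ s))))
                                                          (0# ≟ _) (0# ≟ _))
  one-dilation     s≉0 (suc k) z = refl

  module Fold {extend : Carrier → Series → Series} (isExtension : IsExtension extend) where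

    open IsExtension isExtension

    fold : List Carrier → Series
    fold = List.foldr extend one

    fold-zero : ∀ ws z → fold ws zero z ≡ one zero z
    fold-zero []       z = refl
    fold-zero (w ∷ ws) z = trans (zero-coefficient w (fold ws) z) (fold-zero ws z)

    fold-congruent : ∀ ws → Congruent (fold ws)
    fold-congruent []       = one-congruent
    fold-congruent (w ∷ ws) = preserves-congruent w (fold-congruent ws)

    fold-↭ : ∀ {ws ws′} → ws ↭ ws′ → fold ws ≋ fold ws′
    fold-↭ ↭.refl                      = λ _ _ → refl
    fold-↭ (↭.prep w ws↭ws′)           = ≋-cong w (fold-↭ ws↭ws′)
    fold-↭ (↭.swap {xs = ws} a b ws↭ws′) k z =
      trans (comm a b (fold-congruent ws) k z) (≋-cong b (≋-cong a (fold-↭ ws↭ws′)) k z)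
    fold-↭ (↭.trans ws↭us us↭ws′) k z  = trans (fold-↭ ws↭us k z) (fold-↭ us↭ws′ k z)

    fold-dilation : ∀ {s} {A : Set} (e e′ : A → Carrier) → ¬ s ≈ 0# → (∀ a → e′ a ≈ s *ᶠ e a) →
                    ∀ as k z → fold (List.map e′ as) k (s *ᶠ z) ≡ fold (List.map e as) k z
    fold-dilation e e′ s≉0 e′≈se []       = one-dilation s≉0
    fold-dilation e e′ s≉0 e′≈se (a ∷ as) =
      dilation s≉0 (e′≈se a) (fold-congruent (List.map e′ as)) (fold-dilation e e′ s≉0 e′≈se as)

    fold-elements-dilation : ∀ k {y} → ¬ y ≈ 0# → fold elements k y ≡ fold elements k 1#
    fold-elements-dilation k {y} y≉0 with dilationPermutation y≉0
    ... | σ , enum∘σ≈y*enum , σ-permutes = begin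
      fold elements k y                                     ≡⟨ fold-congruent elements k (R.sym (R.*-identityʳ y)) ⟩
      fold elements k (y *ᶠ 1#)                             ≡⟨ fold-↭ (↭.map⁺ enum σ-permutes) k _ ⟨
      fold (List.map enum (List.map σ (allFin size))) k (y *ᶠ 1#) ≡⟨ cong (λ ws → fold ws k (y *ᶠ 1#)) (map-∘ (allFin size)) ⟨
      fold (List.map (enum ∘ σ) (allFin size)) k (y *ᶠ 1#)
        ≡⟨ fold-dilation enum (enum ∘ σ) y≉0 enum∘σ≈y*enum (allFin size) k 1# ⟩
      fold elements k 1#                                    ∎
      where open ≡-Reasoning

  open Fold subsets-isExtension public using ()
    renaming (fold to subsets; fold-zero to subsets-zero; fold-congruent to subsets-congruent;
              fold-elements-dilation to subsets-elements-dilation)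
  open Fold multisets-isExtension public using ()
    renaming (fold to multisets; fold-zero to multisets-zero; fold-congruent to multisets-congruent;
              fold-elements-dilation to multisets-elements-dilation)

  module _ {n : ℕ} where

    weightsNonzero : ∀ {k} → (Fin n → Carrier) → Vec (Fin n) k → Bool
    weightsNonzero e []      = true
    weightsNonzero e (x ∷ v) = nonzero (e x) ∧ weightsNonzero e v

    weight : ∀ {k} → (Fin n → Carrier) → Vec (Fin n) k → Carrier
    weight e []      = 0#
    weight e (x ∷ v) = e x +ᶠ weight e v

    hasWeight : ∀ {k} → (Fin n → Carrier) → Carrier → Vec (Fin n) k → Bool
    hasWeight e z v = weightsNonzero e v ∧ does (weight e v ≟ z)

    hasWeight-∷ : ∀ {k} (e : Fin n → Carrier) z x (v : Vec (Fin n) k) →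
                  hasWeight e z (x ∷ v) ≡ nonzero (e x) ∧ hasWeight e (z -ᶠ e x) v
    hasWeight-∷ e z x v = trans (∧-assoc (nonzero (e x)) (weightsNonzero e v) _)
      (cong (λ b → nonzero (e x) ∧ weightsNonzero e v ∧ b)
            (does-⇔ (a+s≈z⇔s≈z-a (e x) (weight e v) z) ((e x +ᶠ weight e v) ≟ z) (weight e v ≟ (z -ᶠ e x))))

  module _ {m n : ℕ} (g : Fin m → Fin n) (e : Fin n → Carrier) where

    weightsNonzero-map : ∀ {k} (v : Vec (Fin m) k) → weightsNonzero e (Vec.map g v) ≡ weightsNonzero (e ∘ g) v
    weightsNonzero-map []      = refl
    weightsNonzero-map (x ∷ v) = cong (nonzero (e (g x)) ∧_) (weightsNonzero-map v)

    weight-map : ∀ {k} (v : Vec (Fin m) k) → weight e (Vec.map g v) ≡ weight (e ∘ g) v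
    weight-map []      = refl
    weight-map (x ∷ v) = cong (e (g x) +ᶠ_) (weight-map v)

    hasWeight-map : ∀ {k} z (v : Vec (Fin m) k) → hasWeight e z (Vec.map g v) ≡ hasWeight (e ∘ g) z v
    hasWeight-map z v = cong₂ (λ b s → b ∧ does (s ≟ z)) (weightsNonzero-map v) (weight-map v)

  map-allFin-suc : ∀ {n} (e : Fin (suc n) → Carrier) → List.map e (allFin (suc n)) ≡ e zero ∷ List.map (e ∘ suc) (allFin n)
  map-allFin-suc {n} e = trans (cong (List.map e) (allFin-suc n)) (cong (e zero ∷_) (sym (map-∘ (allFin n))))

  count-nonDecr : ∀ n (e : Fin n → Carrier) k z →
    count (λ v → nonDecr v ∧ hasWeight e z v) (allVecs n k) ≡ multisets (List.map e (allFin n)) k z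
  count-nonDecr n       e zero    z = trans (ℕ.+-identityʳ _) (sym (multisets-zero (List.map e (allFin n)) z))
  count-nonDecr zero    e (suc k) z = refl
  count-nonDecr (suc n) e (suc k) z = begin
    count p (allVecs (suc n) (suc k))
      ≡⟨ count-byHead k p (λ j v → trans (cong (_∧ hasWeight e z (suc j ∷ v)) (nonDecr-suc∷ j v))
                                         (∧-assoc (avoidsZero v) (nonDecr (suc j ∷ v)) (hasWeight e z (suc j ∷ v)))) ⟩
    count (p ∘ (zero ∷_)) (allVecs (suc n) k) + count (p ∘ Vec.map suc) (allVecs n (suc k))
      ≡⟨ ℕ.+-comm (count (p ∘ (zero ∷_)) (allVecs (suc n) k)) _ ⟩
    count (p ∘ Vec.map suc) (allVecs n (suc k)) + count (p ∘ (zero ∷_)) (allVecs (suc n) k)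
      ≡⟨ cong₂ _+_ tail-part (trans head-factor (cong ([ nonzero e₀ ]·_) head-part)) ⟩
    multisets ws (suc k) z + [ nonzero e₀ ]· multisets (e₀ ∷ ws) k (z -ᶠ e₀)
      ≡⟨ cong (λ us → multisets us (suc k) z) (map-allFin-suc e) ⟨
    multisets (List.map e (allFin (suc n))) (suc k) z
      ∎
    where
    open ≡-Reasoning
    e₀ = e zero
    ws = List.map (e ∘ suc) (allFin n)
    p : Vec (Fin (suc n)) (suc k) → Bool
    p v = nonDecr v ∧ hasWeight e z v
    tail-part : count (p ∘ Vec.map suc) (allVecs n (suc k)) ≡ multisets ws (suc k) z
    tail-part = trans (count-cong (λ v → cong₂ _∧_ (nonDecr-map-suc v) (hasWeight-map suc e z v)) (allVecs n (suc k)))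
                      (count-nonDecr n (e ∘ suc) (suc k) z)
    head-factor : count (p ∘ (zero ∷_)) (allVecs (suc n) k)
                  ≡ [ nonzero e₀ ]· count (λ v → nonDecr v ∧ hasWeight e (z -ᶠ e₀) v) (allVecs (suc n) k)
    head-factor = trans (count-cong (λ v → trans (cong₂ _∧_ (nonDecr-zero∷ v) (hasWeight-∷ e z zero v))
                                                 (∧-CS.x∙yz≈y∙xz (nonDecr v) (nonzero e₀) _)) (allVecs (suc n) k))
                        (count-∧ˡ (nonzero e₀) _ (allVecs (suc n) k))
    head-part : count (λ v → nonDecr v ∧ hasWeight e (z -ᶠ e₀) v) (allVecs (suc n) k) ≡ multisets (e₀ ∷ ws) k (z -ᶠ e₀)
    head-part = trans (count-nonDecr (suc n) e k (z -ᶠ e₀)) (cong (λ us → multisets us k (z -ᶠ e₀)) (map-allFin-suc e))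

  count-strictIncr : ∀ n (e : Fin n → Carrier) k z →
    count (λ v → strictIncr v ∧ hasWeight e z v) (allVecs n k) ≡ subsets (List.map e (allFin n)) k z
  count-strictIncr n       e zero    z = trans (ℕ.+-identityʳ _) (sym (subsets-zero (List.map e (allFin n)) z))
  count-strictIncr zero    e (suc k) z = refl
  count-strictIncr (suc n) e (suc k) z = begin
    count p (allVecs (suc n) (suc k))
      ≡⟨ count-byHead k p (λ j v → trans (cong (_∧ hasWeight e z (suc j ∷ v)) (strictIncr-suc∷ j v))
                                         (∧-assoc (avoidsZero v) (strictIncr (suc j ∷ v)) (hasWeight e z (suc j ∷ v)))) ⟩
    count (p ∘ (zero ∷_)) (allVecs (suc n) k) + count (p ∘ Vec.map suc) (allVecs n (suc k))
      ≡⟨ ℕ.+-comm (count (p ∘ (zero ∷_)) (allVecs (suc n) k)) _ ⟩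
    count (p ∘ Vec.map suc) (allVecs n (suc k)) + count (p ∘ (zero ∷_)) (allVecs (suc n) k)
      ≡⟨ cong₂ _+_ tail-part (trans head-factor (cong ([ nonzero e₀ ]·_) head-part)) ⟩
    subsets ws (suc k) z + [ nonzero e₀ ]· subsets ws k (z -ᶠ e₀)
      ≡⟨ cong (λ us → subsets us (suc k) z) (map-allFin-suc e) ⟨
    subsets (List.map e (allFin (suc n))) (suc k) z
      ∎
    where
    open ≡-Reasoning
    e₀ = e zero
    ws = List.map (e ∘ suc) (allFin n)
    p : Vec (Fin (suc n)) (suc k) → Bool
    p v = strictIncr v ∧ hasWeight e z v
    q : ∀ {m} → (Fin m → Carrier) → Vec (Fin m) k → Bool
    q e′ v = strictIncr v ∧ hasWeight e′ (z -ᶠ e₀) v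
    tail-part : count (p ∘ Vec.map suc) (allVecs n (suc k)) ≡ subsets ws (suc k) z
    tail-part = trans (count-cong (λ v → cong₂ _∧_ (strictIncr-map-suc v) (hasWeight-map suc e z v)) (allVecs n (suc k)))
                      (count-strictIncr n (e ∘ suc) (suc k) z)
    head-factor : count (p ∘ (zero ∷_)) (allVecs (suc n) k)
                  ≡ [ nonzero e₀ ]· count (λ v → avoidsZero v ∧ q e v) (allVecs (suc n) k)
    head-factor = trans (count-cong (λ v → trans (cong₂ _∧_ (strictIncr-zero∷ v) (hasWeight-∷ e z zero v))
                                                 (regroup (avoidsZero v) (strictIncr v) (nonzero e₀) _)) (allVecs (suc n) k))
                        (count-∧ˡ (nonzero e₀) _ (allVecs (suc n) k))
      where
      regroup : ∀ a s b h → (a ∧ s) ∧ (b ∧ h) ≡ b ∧ (a ∧ (s ∧ h))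
      regroup a s b h = trans (∧-assoc a s (b ∧ h)) (trans (cong (a ∧_) (∧-CS.x∙yz≈y∙xz s b h)) (∧-CS.x∙yz≈y∙xz a b (s ∧ h)))
    head-part : count (λ v → avoidsZero v ∧ q e v) (allVecs (suc n) k) ≡ subsets ws k (z -ᶠ e₀)
    head-part = begin
      count (λ v → avoidsZero v ∧ q e v) (allVecs (suc n) k)  ≡⟨ count-avoidsZero k (q e) ⟩
      count (q e ∘ Vec.map suc) (allVecs n k)
        ≡⟨ count-cong (λ v → cong₂ _∧_ (strictIncr-map-suc v) (hasWeight-map suc e _ v)) (allVecs n k) ⟩
      count (q (e ∘ suc)) (allVecs n k)                       ≡⟨ count-strictIncr n (e ∘ suc) k (z -ᶠ e₀) ⟩
      subsets ws k (z -ᶠ e₀)                                  ∎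

  private
    hasWeight-enum : ∀ {k} z (v : Vec (Fin size) k) → allNonzero F v ∧ sumIs F z v ≡ hasWeight enum z v
    hasWeight-enum z v = cong₂ (λ b s → b ∧ does (s ≟ z)) (allNonzero≡weightsNonzero v) (vsum≡weight v)
      where
      allNonzero≡weightsNonzero : ∀ {k} (v : Vec (Fin size) k) → allNonzero F v ≡ weightsNonzero enum v
      allNonzero≡weightsNonzero []      = refl
      allNonzero≡weightsNonzero (x ∷ v) = cong (nonzero (enum x) ∧_) (allNonzero≡weightsNonzero v)
      vsum≡weight : ∀ {k} (v : Vec (Fin size) k) → vsum F v ≡ weight enum v
      vsum≡weight []      = refl
      vsum≡weight (x ∷ v) = cong (enum x +ᶠ_) (vsum≡weight v)

  N≡subsets : ∀ k z → N F k z ≡ subsets elements k z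
  N≡subsets k z = begin
    N F k z                                                                ≡⟨ length-filterᵇ _ (allVecs size k) ⟩
    count (λ v → strictIncr v ∧ allNonzero F v ∧ sumIs F z v) (allVecs size k)
      ≡⟨ count-cong (λ v → cong (strictIncr v ∧_) (hasWeight-enum z v)) (allVecs size k) ⟩
    count (λ v → strictIncr v ∧ hasWeight enum z v) (allVecs size k)         ≡⟨ count-strictIncr size enum k z ⟩
    subsets elements k z                                                   ∎
    where open ≡-Reasoning

  Ptilde≡multisets : ∀ k z → Ptilde F k z ≡ multisets elements k z
  Ptilde≡multisets k z = begin
    Ptilde F k z                                                           ≡⟨ length-filterᵇ _ (allVecs size k) ⟩
    count (λ v → nonDecr v ∧ allNonzero F v ∧ sumIs F z v) (allVecs size k)
      ≡⟨ count-cong (λ v → cong (nonDecr v ∧_) (hasWeight-enum z v)) (allVecs size k) ⟩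
    count (λ v → nonDecr v ∧ hasWeight enum z v) (allVecs size k)            ≡⟨ count-nonDecr size enum k z ⟩
    multisets elements k z                                                 ∎
    where open ≡-Reasoning

  convolution : Series → Series → ℕ → ℕ → Carrier → ℕ
  convolution f g k l z = ∑[ y ∈ elements ] f k y ℕ.* g l (z -ᶠ y)

  module _ {a : Carrier} (a≉0 : nonzero a ≡ true) {f g : Series} (f-cong : Congruent f) (g-cong : Congruent g) where

    private
      f⁺ = extendSubsets a f
      g⁺ = extendMultisets a g

    convolution-extend₂ : ∀ k l z →
      convolution f⁺ g⁺ k (suc l) z ≡ convolution f⁺ g k (suc l) z + convolution f⁺ g⁺ k l (z -ᶠ a)
    convolution-extend₂ k l z = trans (∑-cong term elements) (∑-+ _ _ elements)
      where
      term : ∀ y → f⁺ k y ℕ.* g⁺ (suc l) (z -ᶠ y) ≡ f⁺ k y ℕ.* g (suc l) (z -ᶠ y) + f⁺ k y ℕ.* g⁺ l (z -ᶠ a -ᶠ y)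
      term y = begin
        f⁺ k y ℕ.* (g (suc l) (z -ᶠ y) + [ nonzero a ]· g⁺ l (z -ᶠ y -ᶠ a))
          ≡⟨ cong (λ b → f⁺ k y ℕ.* (g (suc l) (z -ᶠ y) + [ b ]· g⁺ l (z -ᶠ y -ᶠ a))) a≉0 ⟩
        f⁺ k y ℕ.* (g (suc l) (z -ᶠ y) + g⁺ l (z -ᶠ y -ᶠ a))
          ≡⟨ ℕ.*-distribˡ-+ (f⁺ k y) _ _ ⟩
        f⁺ k y ℕ.* g (suc l) (z -ᶠ y) + f⁺ k y ℕ.* g⁺ l (z -ᶠ y -ᶠ a)
          ≡⟨ cong (λ t → f⁺ k y ℕ.* g (suc l) (z -ᶠ y) + f⁺ k y ℕ.* t)
                  (Multisets.preserves-congruent a g-cong l ([x-a]-b≈[x-b]-a z y a)) ⟩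
        f⁺ k y ℕ.* g (suc l) (z -ᶠ y) + f⁺ k y ℕ.* g⁺ l (z -ᶠ a -ᶠ y)
          ∎
        where open ≡-Reasoning

    convolution-extend₁ : ∀ k l z →
      convolution f⁺ g (suc k) l z ≡ convolution f g (suc k) l z + convolution f g k l (z -ᶠ a)
    convolution-extend₁ k l z = begin
      ∑[ y ∈ elements ] f⁺ (suc k) y ℕ.* g l (z -ᶠ y)
        ≡⟨ ∑-cong term elements ⟩
      ∑[ y ∈ elements ] (f (suc k) y ℕ.* g l (z -ᶠ y) + f k (y -ᶠ a) ℕ.* g l (z -ᶠ y))
        ≡⟨ ∑-+ _ _ elements ⟩
      convolution f g (suc k) l z + (∑[ y ∈ elements ] f k (y -ᶠ a) ℕ.* g l (z -ᶠ y))
        ≡⟨ cong₂ _+_ refl shift ⟩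
      convolution f g (suc k) l z + convolution f g k l (z -ᶠ a)
        ∎
      where
      open ≡-Reasoning
      term : ∀ y → f⁺ (suc k) y ℕ.* g l (z -ᶠ y) ≡ f (suc k) y ℕ.* g l (z -ᶠ y) + f k (y -ᶠ a) ℕ.* g l (z -ᶠ y)
      term y = trans (cong (λ b → (f (suc k) y + [ b ]· f k (y -ᶠ a)) ℕ.* g l (z -ᶠ y)) a≉0)
                     (ℕ.*-distribʳ-+ (g l (z -ᶠ y)) (f (suc k) y) _)
      shift : ∑[ y ∈ elements ] f k (y -ᶠ a) ℕ.* g l (z -ᶠ y) ≡ convolution f g k l (z -ᶠ a)
      shift = trans (∑-translation a _ (λ y≈y′ → cong₂ ℕ._*_ (f-cong k (R.+-congʳ y≈y′))
                                                             (g-cong l (R.+-congˡ (R.-‿cong y≈y′)))))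
                    (∑-cong (λ y → cong₂ ℕ._*_ (f-cong k (//-rightDividesʳ a y)) (g-cong l (x-[y+a]≈[x-a]-y z y a))) elements)

    alternating-convolution-extend : ∀ m z → alternating (λ k l → convolution f⁺ g⁺ k l z) m
                                             ≡ alternating (λ k l → convolution f g k l z) m
    alternating-convolution-extend zero    z = refl
    alternating-convolution-extend (suc m) z = begin
      alternating (λ k l → convolution f⁺ g⁺ k l z) (suc m)
        ≡⟨ alternating-split₂ (λ k l → convolution f⁺ g⁺ k l z) (λ k l → convolution f⁺ g k l z)
                              (λ k l → convolution f⁺ g⁺ k l (z -ᶠ a)) (λ _ → refl) (λ k l → convolution-extend₂ k l z) m ⟩
      alternating (λ k l → convolution f⁺ g k l z) (suc m) +ℤ alternating (λ k l → convolution f⁺ g⁺ k l (z -ᶠ a)) m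
        ≡⟨ cong₂ _+ℤ_ (alternating-split₁ (λ k l → convolution f⁺ g k l z) (λ k l → convolution f g k l z)
                                          (λ k l → convolution f g k l (z -ᶠ a)) (λ _ → refl) (λ k l → convolution-extend₁ k l z) m)
                      (alternating-convolution-extend m (z -ᶠ a)) ⟩
      alternating (λ k l → convolution f g k l z) (suc m) -ℤ alternating (λ k l → convolution f g k l (z -ᶠ a)) m
        +ℤ alternating (λ k l → convolution f g k l (z -ᶠ a)) m
        ≡⟨ ℤ-//-rightDividesˡ (alternating (λ k l → convolution f g k l (z -ᶠ a)) m) _ ⟩
      alternating (λ k l → convolution f g k l z) (suc m)
        ∎
      where
      open ≡-Reasoning
      open AbelianGroupProperties ℤ.+-0-abelianGroup using () renaming (//-rightDividesˡ to ℤ-//-rightDividesˡ)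

  module _ {a : Carrier} (a≈0 : nonzero a ≡ false) where

    extendSubsets-zero : ∀ f → extendSubsets a f ≋ f
    extendSubsets-zero f zero    z = refl
    extendSubsets-zero f (suc k) z = trans (cong (λ b → f (suc k) z + [ b ]· f k (z -ᶠ a)) a≈0) (ℕ.+-identityʳ _)

    extendMultisets-zero : ∀ f → extendMultisets a f ≋ f
    extendMultisets-zero f zero    z = refl
    extendMultisets-zero f (suc k) z =
      trans (cong (λ b → f (suc k) z + [ b ]· extendMultisets a f k (z -ᶠ a)) a≈0) (ℕ.+-identityʳ _)

  -- The generating functions satisfy E(-t) H(t) = 1.
  alternating-convolution-vanishes : ∀ ws m z →
    alternating (λ k l → convolution (subsets ws) (multisets ws) k l z) (suc m) ≡ + 0
  alternating-convolution-vanishes [] m z =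
    cong₂ _-ℤ_ (cong +_ (trans (∑-cong (λ y → ℕ.*-zeroʳ (one zero y)) elements) (∑-zero elements)))
               (alternating-zero (λ k l → ∑-zero elements) m)
  alternating-convolution-vanishes (w ∷ ws) m z =
    trans (extend (nonzero w) refl) (alternating-convolution-vanishes ws m z)
    where
    extend : ∀ b → nonzero w ≡ b → alternating (λ k l → convolution (subsets (w ∷ ws)) (multisets (w ∷ ws)) k l z) (suc m)
                                   ≡ alternating (λ k l → convolution (subsets ws) (multisets ws) k l z) (suc m)
    extend true  w≉0 = alternating-convolution-extend w≉0 (subsets-congruent ws) (multisets-congruent ws) (suc m) z
    extend false w≈0 = alternating-cong (λ k l → ∑-cong (λ y →
      cong₂ ℕ._*_ (extendSubsets-zero w≈0 (subsets ws) k y) (extendMultisets-zero w≈0 (multisets ws) l (z -ᶠ y))) elements) (suc m)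

  count-≈-elements : ∀ x → count (λ y → does (y ≟ x)) elements ≡ 1
  count-≈-elements x with enum-surj x
  ... | i₀ , enum-i₀≈x = begin
    count (λ y → does (y ≟ x)) elements                ≡⟨ ∑-map _ enum (allFin size) ⟩
    count (λ i → does (enum i ≟ x)) (allFin size)
      ≡⟨ count-cong (λ i → does-⇔ (enum-i≈x⇔i≡i₀ i) (enum i ≟ x) (i Finₚ.≟ i₀)) (allFin size) ⟩
    count (λ i → does (i Finₚ.≟ i₀)) (allFin size)     ≡⟨ count-≟-allFin size i₀ ⟩
    1                                                  ∎
    where
    open ≡-Reasoning
    enum-i≈x⇔i≡i₀ : ∀ i → (enum i ≈ x) ⇔ (i ≡ i₀)
    enum-i≈x⇔i≡i₀ i = mk⇔ (λ enum-i≈x → enum-inj i i₀ (R.trans enum-i≈x (R.sym enum-i₀≈x)))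
                          (λ i≡i₀ → subst (λ j → enum j ≈ x) (sym i≡i₀) enum-i₀≈x)

  ∑-elements-const-on-nonzero : ∀ (g : Carrier → ℕ) B → g Preserves _≈_ ⟶ _≡_ → (∀ y → ¬ y ≈ 0# → g y ≡ B) →
                         + ∑ elements g ≡ (+ size -ℤ + 1) * + B +ℤ + g 0#
  ∑-elements-const-on-nonzero g B g-cong g-const = begin
    + ∑ elements g
      ≡⟨ cong +_ (∑-cong split elements) ⟩
    + (∑[ y ∈ elements ] (if isZero y then g 0# else B))
      ≡⟨ cong +_ (∑-if isZero (g 0#) B elements) ⟩
    + (count isZero elements ℕ.* g 0# + count nonzero elements ℕ.* B)
      ≡⟨ cong (λ n → + (n ℕ.* g 0# + count nonzero elements ℕ.* B)) (count-≈-elements 0#) ⟩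
    + (1 ℕ.* g 0# + count nonzero elements ℕ.* B)
      ≡⟨ trans (cong +_ (ℕ.+-comm (1 ℕ.* g 0#) _))
               (cong₂ _+ℤ_ (ℤ.pos-* (count nonzero elements) B) (cong +_ (ℕ.*-identityˡ (g 0#)))) ⟩
    + count nonzero elements * + B +ℤ + g 0#
      ≡⟨ cong (λ n → (+ n -ℤ + 1) * + B +ℤ + g 0#) size≡1+count-nonzero ⟨
    (+ size -ℤ + 1) * + B +ℤ + g 0#
      ∎
    where
    open ≡-Reasoning
    isZero : Carrier → Bool
    isZero y = does (y ≟ 0#)
    split : ∀ y → g y ≡ (if isZero y then g 0# else B)
    split y with y ≟ 0#
    ... | yes y≈0 = g-cong y≈0
    ... | no  y≉0 = g-const y y≉0
    size≡1+count-nonzero : size ≡ suc (count nonzero elements)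
    size≡1+count-nonzero = begin
      size                                              ≡⟨ length-tabulate id ⟨
      length (allFin size)                              ≡⟨ length-map enum (allFin size) ⟨
      length elements                                   ≡⟨ count-+-count-not isZero elements ⟨
      count isZero elements + count nonzero elements    ≡⟨ cong (_+ count nonzero elements) (count-≈-elements 0#) ⟩
      suc (count nonzero elements)                      ∎

  convolution-at-0 : ∀ k l →
    + convolution (subsets elements) (multisets elements) k l 0#
      ≡ (+ size -ℤ + 1) * + subsets elements k 1# * + multisets elements l 1# +ℤ + subsets elements k 0# * + multisets elements l 0#
  convolution-at-0 k l = begin
    + ∑ elements g
      ≡⟨ ∑-elements-const-on-nonzero g (E 1# ℕ.* H 1#) g-cong g-const ⟩
    (+ size -ℤ + 1) * + (E 1# ℕ.* H 1#) +ℤ + g 0#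
      ≡⟨ cong₂ _+ℤ_ (trans (cong ((+ size -ℤ + 1) *_) (ℤ.pos-* (E 1#) (H 1#))) (sym (ℤ.*-assoc (+ size -ℤ + 1) _ _)))
                    (trans (cong (λ t → + (E 0# ℕ.* t)) (multisets-congruent elements l (R.-‿inverseʳ 0#)))
                           (ℤ.pos-* (E 0#) (H 0#))) ⟩
    (+ size -ℤ + 1) * + E 1# * + H 1# +ℤ + E 0# * + H 0#
      ∎
    where
    open ≡-Reasoning
    E = subsets elements k
    H = multisets elements l
    g : Carrier → ℕ
    g y = E y ℕ.* H (0# -ᶠ y)
    g-cong : g Preserves _≈_ ⟶ _≡_
    g-cong y≈y′ = cong₂ ℕ._*_ (subsets-congruent elements k y≈y′) (multisets-congruent elements l (R.+-congˡ (R.-‿cong y≈y′)))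
    g-const : ∀ y → ¬ y ≈ 0# → g y ≡ E 1# ℕ.* H 1#
    g-const y y≉0 = cong₂ ℕ._*_ (subsets-elements-dilation k y≉0) (multisets-elements-dilation l (y≉0 ∘ 0-x≈0⇒x≈0 y))

  one-zero-0# : one zero 0# ≡ 1
  one-zero-0# = cong ([_]· 1) (dec-true (0# ≟ 0#) R.refl)

  one-zero-1# : one zero 1# ≡ 0
  one-zero-1# = cong ([_]· 1) (dec-false (0# ≟ 1#) (1≉0 ∘ R.sym))

  multisets-degree1 : ∀ ws z → multisets ws 1 z ≡ count (λ w → nonzero w ∧ does (w ≟ z)) ws
  multisets-degree1 []       z = refl
  multisets-degree1 (w ∷ ws) z = trans (ℕ.+-comm (multisets ws 1 z) _) (cong₂ _+_ single (multisets-degree1 ws z))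
    where
    single : [ nonzero w ]· multisets ws 0 (z -ᶠ w) ≡ [ nonzero w ∧ does (w ≟ z) ]· 1
    single with nonzero w
    ... | false = refl
    ... | true  = trans (multisets-zero ws (z -ᶠ w)) (cong ([_]· 1) (does-⇔ 0≈z-w⇔w≈z (0# ≟ (z -ᶠ w)) (w ≟ z)))
      where
      open Equivalence (a+s≈z⇔s≈z-a w 0# z)
      0≈z-w⇔w≈z : (0# ≈ z -ᶠ w) ⇔ (w ≈ z)
      0≈z-w⇔w≈z = mk⇔ (λ 0≈z-w → R.trans (R.sym (R.+-identityʳ w)) (from 0≈z-w))
                      (λ w≈z → to (R.trans (R.+-identityʳ w) w≈z))

  multisets-degree1-0# : multisets elements 1 0# ≡ 0
  multisets-degree1-0# = trans (multisets-degree1 elements 0#)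
                               (trans (count-cong (λ w → ∧-inverseˡ (does (w ≟ 0#))) elements) (∑-zero elements))

  multisets-degree1-1# : multisets elements 1 1# ≡ 1
  multisets-degree1-1# = trans (multisets-degree1 elements 1#) (trans (count-cong nonzero-if-1 elements) (count-≈-elements 1#))
    where
    nonzero-if-1 : ∀ w → nonzero w ∧ does (w ≟ 1#) ≡ does (w ≟ 1#)
    nonzero-if-1 w with w ≟ 1#
    ... | yes w≈1 = trans (∧-identityʳ (nonzero w)) (trans (nonzero-cong w≈1) (cong not (dec-false (1# ≟ 0#) 1≉0)))
    ... | no  _   = ∧-zeroʳ (nonzero w)

  summand : ℕ → ℕ → ℤ
  summand k l = (+ size -ℤ + 1) * + N F k 1# * + Ptilde F l 1# +ℤ + N F k 0# * + Ptilde F l 0#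

  convolution≡summand : ∀ k l → + convolution (subsets elements) (multisets elements) k l 0# ≡ summand k l
  convolution≡summand k l = trans (convolution-at-0 k l) (sym (cong₂ _+ℤ_
    (cong₂ (λ n p → (+ size -ℤ + 1) * + n * + p) (N≡subsets k 1#) (Ptilde≡multisets l 1#))
    (cong₂ (λ n p → + n * + p) (N≡subsets k 0#) (Ptilde≡multisets l 0#))))

  module _ where
    open import Data.Integer.Solver using (module +-*-Solver)
    open +-*-Solver

    summand-0ˡ : ∀ l → summand 0 l ≡ + Ptilde F l 0#
    summand-0ˡ l = begin
      (+ size -ℤ + 1) * + N F 0 1# * + Ptilde F l 1# +ℤ + N F 0 0# * + Ptilde F l 0#
        ≡⟨ cong₂ (λ a b → (+ size -ℤ + 1) * + a * + Ptilde F l 1# +ℤ + b * + Ptilde F l 0#)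
                 (trans (N≡subsets 0 1#) (trans (subsets-zero elements 1#) one-zero-1#))
                 (trans (N≡subsets 0 0#) (trans (subsets-zero elements 0#) one-zero-0#)) ⟩
      (+ size -ℤ + 1) * + 0 * + Ptilde F l 1# +ℤ + 1 * + Ptilde F l 0#
        ≡⟨ solve 3 (λ c p₁ p₀ → c :* con (+ 0) :* p₁ :+ con (+ 1) :* p₀ := p₀) refl
                 (+ size -ℤ + 1) (+ Ptilde F l 1#) (+ Ptilde F l 0#) ⟩
      + Ptilde F l 0#
        ∎
      where open ≡-Reasoning

    summand-1ʳ : ∀ k → summand k 1 ≡ (+ size -ℤ + 1) * + N F k 1#
    summand-1ʳ k = begin
      (+ size -ℤ + 1) * + N F k 1# * + Ptilde F 1 1# +ℤ + N F k 0# * + Ptilde F 1 0#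
        ≡⟨ cong₂ (λ a b → (+ size -ℤ + 1) * + N F k 1# * + a +ℤ + N F k 0# * + b)
                 (trans (Ptilde≡multisets 1 1#) multisets-degree1-1#) (trans (Ptilde≡multisets 1 0#) multisets-degree1-0#) ⟩
      (+ size -ℤ + 1) * + N F k 1# * + 1 +ℤ + N F k 0# * + 0
        ≡⟨ solve 3 (λ c n₁ n₀ → c :* n₁ :* con (+ 1) :+ n₀ :* con (+ 0) := c :* n₁) refl
                 (+ size -ℤ + 1) (+ N F k 1#) (+ N F k 0#) ⟩
      (+ size -ℤ + 1) * + N F k 1#
        ∎
      where open ≡-Reasoning

    summand-0ʳ : ∀ k → summand k 0 ≡ + N F k 0#
    summand-0ʳ k = begin
      (+ size -ℤ + 1) * + N F k 1# * + Ptilde F 0 1# +ℤ + N F k 0# * + Ptilde F 0 0#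
        ≡⟨ cong₂ (λ a b → (+ size -ℤ + 1) * + N F k 1# * + a +ℤ + N F k 0# * + b)
                 (trans (Ptilde≡multisets 0 1#) (trans (multisets-zero elements 1#) one-zero-1#))
                 (trans (Ptilde≡multisets 0 0#) (trans (multisets-zero elements 0#) one-zero-0#)) ⟩
      (+ size -ℤ + 1) * + N F k 1# * + 0 +ℤ + N F k 0# * + 1
        ≡⟨ solve 3 (λ c n₁ n₀ → c :* n₁ :* con (+ 0) :+ n₀ :* con (+ 1) := n₀) refl
                 (+ size -ℤ + 1) (+ N F k 1#) (+ N F k 0#) ⟩
      + N F k 0#
        ∎
      where open ≡-Reasoning

  negated-summands : ∀ m n → - sumFrom1 n (λ k → -1ℤ ^ k * summand k (m ∸ k))
                               ≡ sumFrom1 n (λ k → -1ℤ ^ (k + 1) * summand k (m ∸ k))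
  negated-summands m n = trans (sym (sumFrom1-neg _ n)) (sumFrom1-cong (λ k → begin
    - (-1ℤ ^ k * summand k (m ∸ k))  ≡⟨ -1^[1+k]*x≡-[-1^k*x] k _ ⟨
    -1ℤ ^ suc k * summand k (m ∸ k)  ≡⟨ cong (λ e → -1ℤ ^ e * summand k (m ∸ k)) (ℕ.+-comm 1 k) ⟩
    -1ℤ ^ (k + 1) * summand k (m ∸ k) ∎) n)
    where open ≡-Reasoning

  negated-term₁ : ∀ k → - (-1ℤ ^ k * summand k 1) ≡ -1ℤ ^ suc k * (+ size -ℤ + 1) * + N F k 1#
  negated-term₁ k = begin
    - (-1ℤ ^ k * summand k 1)                          ≡⟨ cong (λ t → - (-1ℤ ^ k * t)) (summand-1ʳ k) ⟩
    - (-1ℤ ^ k * ((+ size -ℤ + 1) * + N F k 1#))        ≡⟨ -1^[1+k]*x≡-[-1^k*x] k _ ⟨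
    -1ℤ ^ suc k * ((+ size -ℤ + 1) * + N F k 1#)        ≡⟨ ℤ.*-assoc (-1ℤ ^ suc k) _ _ ⟨
    -1ℤ ^ suc k * (+ size -ℤ + 1) * + N F k 1#          ∎
    where open ≡-Reasoning

  negated-term₀ : ∀ m → - (-1ℤ ^ m * summand m 0) ≡ -1ℤ ^ (m + 1) * + N F m 0#
  negated-term₀ m = begin
    - (-1ℤ ^ m * summand m 0)     ≡⟨ cong (λ t → - (-1ℤ ^ m * t)) (summand-0ʳ m) ⟩
    - (-1ℤ ^ m * + N F m 0#)      ≡⟨ -1^[1+k]*x≡-[-1^k*x] m _ ⟨
    -1ℤ ^ suc m * + N F m 0#      ≡⟨ cong (λ e → -1ℤ ^ e * + N F m 0#) (ℕ.+-comm 1 m) ⟩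
    -1ℤ ^ (m + 1) * + N F m 0#    ∎
    where open ≡-Reasoning

  alternating-identity : ∀ m → + Ptilde F (suc m) 0# +ℤ sumFrom1 (suc m) (λ k → -1ℤ ^ k * summand k (suc m ∸ k)) ≡ + 0
  alternating-identity m = begin
    + Ptilde F (suc m) 0# +ℤ sumFrom1 (suc m) (λ k → -1ℤ ^ k * summand k (suc m ∸ k))
      ≡⟨ cong₂ _+ℤ_ (trans (convolution≡summand 0 (suc m)) (summand-0ˡ (suc m)))
                    (sumFrom1-cong (λ k → cong (-1ℤ ^ k *_) (convolution≡summand k (suc m ∸ k))) (suc m)) ⟨
    + f 0 (suc m) +ℤ sumFrom1 (suc m) (λ k → -1ℤ ^ k * + f k (suc m ∸ k))
      ≡⟨ alternating≡sumFrom1 f (suc m) ⟨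
    alternating f (suc m)
      ≡⟨ alternating-convolution-vanishes elements m 0# ⟩
    + 0
      ∎
    where
    open ≡-Reasoning
    f : ℕ → ℕ → ℕ
    f k l = convolution (subsets elements) (multisets elements) k l 0#

open AbelianGroupProperties ℤ.+-0-abelianGroup using () renaming (inverseˡ-unique to ℤ-inverseˡ-unique)

lemma4 : ∀ {c ℓ} (F : FiniteField c ℓ) (m : ℕ) → 1 < m →
    + Ptilde F m (FiniteField.0# F)
      ≡ (sumFrom1 (m ∸ 2) (λ k → (-1ℤ ^ (k + 1)) *
             ((((+ FiniteField.size F) -ℤ (+ 1)) * (+ N F k (FiniteField.1# F)) * (+ Ptilde F (m ∸ k) (FiniteField.1# F)))
              +ℤ ((+ N F k (FiniteField.0# F)) * (+ Ptilde F (m ∸ k) (FiniteField.0# F)))))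
        +ℤ ((-1ℤ ^ m) * ((+ FiniteField.size F) -ℤ (+ 1)) * (+ N F (m ∸ 1) (FiniteField.1# F))))
        +ℤ ((-1ℤ ^ (m + 1)) * (+ N F m (FiniteField.0# F)))
lemma4 F (suc zero)    (s≤s ())
lemma4 F (suc (suc n)) _ = begin
  + Ptilde F m 0#
    ≡⟨ ℤ-inverseˡ-unique _ _ (alternating-identity F (suc n)) ⟩
  - (sumFrom1 n T +ℤ T (suc n) +ℤ T m)
    ≡⟨ trans (ℤ.neg-distrib-+ (sumFrom1 n T +ℤ T (suc n)) (T m))
             (cong (_+ℤ - T m) (ℤ.neg-distrib-+ (sumFrom1 n T) (T (suc n)))) ⟩
  - sumFrom1 n T +ℤ - T (suc n) +ℤ - T m
    ≡⟨ cong₂ _+ℤ_ (cong₂ _+ℤ_ (negated-summands F m n)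
                              (trans (cong (λ l → - T′ (suc n) l) (ℕ.m+n∸n≡m 1 (suc n))) (negated-term₁ F (suc n))))
                  (trans (cong (λ l → - T′ m l) (ℕ.n∸n≡0 m)) (negated-term₀ F m)) ⟩
  sumFrom1 n (λ k → -1ℤ ^ (k + 1) * summand F k (m ∸ k))
    +ℤ -1ℤ ^ m * (+ size -ℤ + 1) * + N F (suc n) 1# +ℤ -1ℤ ^ (m + 1) * + N F m 0#
    ∎
  where
  open ≡-Reasoning
  open FiniteField F using (size; 0#; 1#)
  m = suc (suc n)
  T′ : ℕ → ℕ → ℤ
  T′ k l = -1ℤ ^ k * summand F k l
  T : ℕ → ℤ
  T k = T′ k (m ∸ k)
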